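{- Let $q$ be a prime power and $1\le t$, $t+2\le n$. For subsets $\tau$ and $\pi$ of $\{1,\ldots,n\}$ let $a^{(n)}_{\tau,\pi}$ denote the number of subspaces in the $B(\mathbb{F}_q^n)$-orbit of $E(\pi)$ containing $E(\tau)$ (the entries of the incidence matrices $A^{B(\mathbb{F}_q^n)}_{|\tau|,|\pi|}$), and similarly $a^{(n-1)}$ for $\mathbb{F}_q^{n-1}$ and subsets of $\{1,\ldots,n-1\}$. Then for all $t$-subsets $\tau$ of $\{1,\ldots,n\}$: (i) if $n\notin\tau$ and $\pi$ is a $(t+1)$-subset containing $n$, then $a^{(n)}_{\tau,\pi}=q^{n-t-1}$ if $\pi=\tau\cup\{n\}$ and $a^{(n)}_{\tau,\pi}=0$ otherwise; (ii) if $n\notin\tau$ and $\pi$ is a $(t+2)$-subset of $\{1,\ldots,n-1\}$, then $a^{(n)}_{\tau,\pi}=a^{(n-1)}_{\tau,\pi}$; (iii) if $n\in\tau$ and $\pi=\sigma\cup\{n\}$ with $\sigma$ a $t$-subset of $\{1,\ldots,n-1\}$, then $a^{(n)}_{\tau,\pi}=a^{(n-1)}_{\tau\setminus\{n\},\sigma}$; (iv) if $n\in\tau$ and $\pi$ is a $(t+2)$-subset of $\{1,\ldots,n-1\}$, then $a^{(n)}_{\tau,\pi}=0$. Equivalently, ordering columns of $A^{B(\mathbb{F}_q^n)}_{t,t+1}\mid A^{B(\mathbb{F}_q^n)}_{t,t+2}$ as ($(t+1)$-subsets containing $n$; $(t+2)$-subsets of $\{1,\ldots,n-1\}$; the rest)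 and rows as ($t$-subsets of $\{1,\ldots,n-1\}$; $t$-subsets containing $n$), the first two column blocks are $\begin{bmatrix} q^{n-t-1}I & A^{B(\mathbb{F}_q^{n-1})}_{t,t+2}\\ A^{B(\mathbb{F}_q^{n-1})}_{t-1,t} & 0\end{bmatrix}$.
   Context: $B(\mathbb{F}_q^m)$ is the group of invertible upper triangular $m\times m$ matrices over $\mathbb{F}_q$, acting on subspaces by $\alpha S=\{\alpha x:x\in S\}$. For $\pi=\{\pi_1,\ldots,\pi_k\}\subseteq\{1,\ldots,m\}$, $E(\pi)=\langle e_{\pi_1},\ldots,e_{\pi_k}\rangle\le\mathbb{F}_q^m$, where $e_j$ is the $j$-th standard unit vector. $A_{s,k}^{B(\mathbb{F}_q^m)}$ is the matrix with rows indexed by $s$-subsets $\tau$ and columns by $k$-subsets $\pi$ of $\{1,\ldots,m\}$, whose $(\tau,\pi)$ entry is the number of subspaces in the $B(\mathbb{F}_q^m)$-orbit of $E(\pi)$ containing $E(\tau)$; $I$ is an identity matrix with rows/columns matched via $\tau\mapsto\tau\cup\{n\}$. -}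

module Defs where

open import Level using (0ℓ)
open import Data.Nat using (ℕ; zero; suc)
open import Data.Fin using (Fin; zero; suc; toℕ)
open import Data.Fin.Subset using (Subset; _∈_; _∉_; _⊆_)
open import Data.Bool using (Bool; true; false)
open import Data.Vec using (Vec; _∷ʳ_)
open import Data.Product using (Σ; ∃; _×_; _,_)
open import Relation.Binary.PropositionalEquality using (_≡_)
open import Relation.Nullary using (¬_)
open import Algebra.Structures using (IsCommutativeRing)
open import Function.Bundles using (_↔_)
import Data.Nat as ℕ

-- A finite field with exactly q elements (equality is propositional).
-- Its order q is then necessarily a prime power, and every prime power
-- q admits one; so "q a prime power, F = F_q" is rendered as
-- "F a finite field with q elements".
record FiniteField (q : ℕ) : Set₁ where
  field
    Carrier : Set
    _+_ _*_ : Carrier → Carrier → Carrier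
    -_      : Carrier → Carrier
    0# 1#   : Carrier
    isCommutativeRing : IsCommutativeRing _≡_ _+_ _*_ -_ 0# 1#
    0≢1     : ¬ (0# ≡ 1#)
    inverse : ∀ x → ¬ (x ≡ 0#) → ∃ λ y → x * y ≡ 1#
    enumeration : Fin q ↔ Carrier

module _ {q : ℕ} (F : FiniteField q) where
  open FiniteField F

  Vector : ℕ → Set
  Vector n = Fin n → Carrier

  Matrix : ℕ → Set
  Matrix n = Fin n → Fin n → Carrier

  ∑ : ∀ {n} → (Fin n → Carrier) → Carrier
  ∑ {zero}  f = 0#
  ∑ {suc n} f = f zero + ∑ (λ i → f (suc i))

  _·_ : ∀ {n} → Matrix n → Vector n → Vector n
  (A · x) i = ∑ (λ j → A i j * x j)

  _⊗_ : ∀ {n} → Matrix n → Matrix n → Matrix n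
  (A ⊗ B) i k = ∑ (λ j → A i j * B j k)

  identity : ∀ {n} → Matrix n
  identity i j with i Data.Fin.≟ j
  ... | Relation.Nullary.yes _ = 1#
  ... | Relation.Nullary.no  _ = 0#

  UpperTriangular : ∀ {n} → Matrix n → Set
  UpperTriangular A = ∀ i j → toℕ j ℕ.< toℕ i → A i j ≡ 0#

  Invertible : ∀ {n} → Matrix n → Set
  Invertible {n} A = Σ (Matrix n) λ B →
    (∀ i j → (A ⊗ B) i j ≡ identity i j) × (∀ i j → (B ⊗ A) i j ≡ identity i j)

  InBorel : ∀ {n} → Matrix n → Set
  InBorel A = UpperTriangular A × Invertible A

  VSubset : ℕ → Set₁
  VSubset n = Vector n → Set

  _≐_ : ∀ {n} → VSubset n → VSubset n → Set
  S ≐ T = ∀ v → (S v → T v) × (T v → S v)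

  _⊑_ : ∀ {n} → VSubset n → VSubset n → Set
  S ⊑ T = ∀ v → S v → T v

  -- E(π) = ⟨ e_j : j ∈ π ⟩ = vectors vanishing outside π
  E : ∀ {n} → Subset n → VSubset n
  E π x = ∀ j → j ∉ π → x j ≡ 0#

  _▸_ : ∀ {n} → Matrix n → VSubset n → VSubset n
  (α ▸ S) v = Σ _ λ x → S x × (∀ i → (α · x) i ≡ v i)

  InOrbitOfE : ∀ {n} → Subset n → VSubset n → Set
  InOrbitOfE π S = Σ (Matrix _) λ α → InBorel α × (S ≐ (α ▸ E π))

  -- "the number of subspaces in the B(F_q^n)-orbit of E(π) containing E(τ)
  --  equals N": there are exactly N such subspaces, pairwise distinct (as
  --  sets of vectors), listed by S : Fin N → VSubset n, and every such
  --  subspace equals one of them.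
  IncidenceCount : (n : ℕ) → Subset n → Subset n → ℕ → Set₁
  IncidenceCount n τ π N =
    Σ (Fin N → VSubset n) λ S →
      (∀ i → InOrbitOfE π (S i) × (E τ ⊑ S i))
    × (∀ i j → S i ≐ S j → i ≡ j)
    × (∀ T → InOrbitOfE π T → E τ ⊑ T → ∃ λ i → T ≐ S i)

-- Subsets of {1..n} for n = suc m are Vec Bool (suc m); the last
-- coordinate (index m, 0-based) is the element "n".
-- σ ↦ σ (as a subset of {1..n} not containing n)
embed : ∀ {m} → Subset m → Subset (suc m)
embed σ = σ ∷ʳ false

addLast : ∀ {m} → Subset m → Subset (suc m)
addLast σ = σ ∷ʳ true

-- For an invertible upper triangular α, back substitution shows that E(τ) ⊆ α E(π) forces τ ⊆ π,
-- and that E(τ) ⊆ α E(τ) forces α E(τ) ⊆ E(τ).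
-- If n lies in both τ and π, or in neither, cutting a subspace of F^n with the hyperplane xₙ = 0 and
-- extending a subspace of F^(n-1) by the block matrix [[α , 0] , [0 , 1]] are mutually inverse on the
-- incident subspaces, so the two counts agree. If π = τ ∪ {n} with n ∉ τ, then α fixes E(τ), so each
-- incident subspace is E(τ) ⊕ ⟨(c , 1)⟩ for a unique c ∈ F^(∁τ): there are q^(n-1-|τ|) of them.
-- In the other cases of (i), and in (iv), τ ⊄ π and there are none. That the counts in (ii) and (iii)
-- exist at all is seen by brute force: the orbit is listed by the finitely many Borel matrices, and
-- membership, inclusion and equality of the subspaces involved are decidable.

module Submission where

open import Level using (0ℓ)
open import Data.Nat as ℕ using (ℕ; zero; suc)
open import Data.Nat.Properties using (<⇒≢; <-irrefl; <-asym)
open import Data.Fin as Fin using (Fin; zero; suc; toℕ; inject₁; fromℕ; finToFun; funToFin)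
open import Data.Fin.Properties
  using (all?; any?; finToFun-funToFin; toℕ-fromℕ; inject₁ℕ<; toℕ-inject₁; fromℕ≢inject₁; inject₁-injective;
         suc-injective; punchInᵢ≢i; combine-remQuot; remQuot-combine)
open import Data.Fin.Relation.Unary.Top using (view; ‵fromℕ; ‵inject₁)
open import Data.Fin.Subset using (Subset; Side; _∈_; _∉_; _⊆_; ∣_∣; ∁; inside; outside)
open import Data.Fin.Subset.Properties using (_∈?_; ⊆-antisym; p⊂q⇒∣p∣<∣q∣; drop-there; ∣∁p∣≡n∸∣p∣)
open import Data.Vec using ([]; _∷_; _∷ʳ_; here; there)
open import Data.Vec.Functional using (init; last; tail; replicate)
open import Data.Product using (∃; _×_; _,_; proj₁; proj₂; swap; map₁)
open import Function using (_∘_; _$_)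
open import Function.Bundles using (Inverse; Injection)
open import Function.Properties.Inverse using (↔⇒↣)
open import Algebra.Bundles using (CommutativeRing)
open import Relation.Nullary using (¬_; ¬?; Dec; yes; no; contradiction)
open import Relation.Nullary.Decidable using (_×-dec_; _→-dec_; map′)
open import Relation.Binary.PropositionalEquality
open import Defs
  using (FiniteField; module FiniteField; Vector; Matrix; VSubset; UpperTriangular; InBorel; InOrbitOfE;
         IncidenceCount; embed; addLast)
import Defs as D

p⊆q∧∣p∣≡∣q∣⇒p≡q : ∀ {n} {p q : Subset n} → p ⊆ q → ∣ p ∣ ≡ ∣ q ∣ → p ≡ q
p⊆q∧∣p∣≡∣q∣⇒p≡q {p = p} {q} p⊆q ∣p∣≡∣q∣ = ⊆-antisym p⊆q q⊆p
  where
  q⊆p : q ⊆ p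
  q⊆p {x} x∈q with x ∈? p
  ... | yes x∈p = x∈p
  ... | no  x∉p = contradiction ∣p∣≡∣q∣ (<⇒≢ (p⊂q⇒∣p∣<∣q∣ (p⊆q , x , x∈q , x∉p)))

inject₁<fromℕ : ∀ {m} (j : Fin m) → toℕ (inject₁ j) ℕ.< toℕ (fromℕ m)
inject₁<fromℕ {m} j = subst (toℕ (inject₁ j) ℕ.<_) (sym (toℕ-fromℕ m)) (inject₁ℕ< j)

inject₁∈∷ʳ⁺ : ∀ {m} {p : Subset m} {b j} → j ∈ p → inject₁ j ∈ p ∷ʳ b
inject₁∈∷ʳ⁺ here      = here
inject₁∈∷ʳ⁺ (there j∈p) = there (inject₁∈∷ʳ⁺ j∈p)

inject₁∈∷ʳ⁻ : ∀ {m} {p : Subset m} {b j} → inject₁ j ∈ p ∷ʳ b → j ∈ p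
inject₁∈∷ʳ⁻ {p = _ ∷ _} {j = zero}  here      = here
inject₁∈∷ʳ⁻ {p = _ ∷ _} {j = suc j} (there j∈p) = there (inject₁∈∷ʳ⁻ j∈p)

fromℕ∈∷ʳinside : ∀ {m} (p : Subset m) → fromℕ m ∈ p ∷ʳ inside
fromℕ∈∷ʳinside []      = here
fromℕ∈∷ʳinside (_ ∷ p) = there (fromℕ∈∷ʳinside p)

fromℕ∉∷ʳoutside : ∀ {m} (p : Subset m) → fromℕ m ∉ p ∷ʳ outside
fromℕ∉∷ʳoutside (_ ∷ p) (there n∈p) = fromℕ∉∷ʳoutside p n∈p

fromℕ∉∷ʳ⇒outside : ∀ {m} (p : Subset m) {b} → fromℕ m ∉ p ∷ʳ b → b ≡ outside
fromℕ∉∷ʳ⇒outside p {inside}  n∉p = contradiction (fromℕ∈∷ʳinside p) n∉p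
fromℕ∉∷ʳ⇒outside p {outside} _   = refl

module _ {A : Set} where

  snoc : ∀ {m} → (Fin m → A) → A → Fin (suc m) → A
  snoc {zero}  v c zero    = c
  snoc {suc m} v c zero    = v zero
  snoc {suc m} v c (suc i) = snoc (v ∘ suc) c i

  init-snoc : ∀ {m} (v : Fin m → A) c j → init (snoc v c) j ≡ v j
  init-snoc {suc m} v c zero    = refl
  init-snoc {suc m} v c (suc j) = init-snoc (v ∘ suc) c j

  last-snoc : ∀ {m} (v : Fin m → A) c → last (snoc v c) ≡ c
  last-snoc {zero}  v c = refl
  last-snoc {suc m} v c = last-snoc (v ∘ suc) c

  snoc-init-last : ∀ {m} (w : Fin (suc m) → A) i → snoc (init w) (last w) i ≡ w i
  snoc-init-last w i with view i
  ... | ‵fromℕ     = last-snoc (init w) (last w)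
  ... | ‵inject₁ j = init-snoc (init w) (last w) j

record Enumeration (A : Set) (_≈_ : A → A → Set) : Set where
  field
    size            : ℕ
    enum            : Fin size → A
    enum-surjective : ∀ a → ∃ λ k → enum k ≈ a

enumeration-→ : ∀ {A _≈_} n → Enumeration A _≈_ →
  Enumeration (Fin n → A) (λ f g → ∀ i → f i ≈ g i)
enumeration-→ {_≈_ = _≈_} n e = record
  { size            = size ℕ.^ n
  ; enum            = λ k i → enum (finToFun k i)
  ; enum-surjective = λ f → funToFin (index ∘ f) , λ i →
      subst (λ k → enum k ≈ f i) (sym (finToFun-funToFin (index ∘ f) i)) (proj₂ (enum-surjective (f i)))
  }
  where
  open Enumeration e
  index = λ a → proj₁ (enum-surjective a)

module Enumerated {A _≈_} (e : Enumeration A _≈_) (≈-sym : ∀ {a b} → a ≈ b → b ≈ a)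
                  {P : A → Set} (P-resp : ∀ {a b} → a ≈ b → P a → P b) (P? : ∀ a → Dec (P a)) where
  open Enumeration e

  all?ᵉ : Dec (∀ a → P a)
  all?ᵉ with all? (P? ∘ enum)
  ... | yes ∀P = yes λ a → P-resp (proj₂ (enum-surjective a)) (∀P (proj₁ (enum-surjective a)))
  ... | no ¬∀P = no λ ∀P → ¬∀P (∀P ∘ enum)

  any?ᵉ : Dec (∃ P)
  any?ᵉ with any? (P? ∘ enum)
  ... | yes (k , p) = yes (enum k , p)
  ... | no ¬∃P      = no λ (a , p) → ¬∃P (proj₁ (enum-surjective a) , P-resp (≈-sym (proj₂ (enum-surjective a))) p)

module _ {A : Set} {P : A → Set} (P? : ∀ a → Dec (P a))
         {_≈_ : A → A → Set} (_≈?_ : ∀ a b → Dec (a ≈ b))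
         (≈-refl : ∀ {a} → a ≈ a) (≈-sym : ∀ {a b} → a ≈ b → b ≈ a) where

  record Transversal {K} (e : Fin K → A) : Set where
    field
      size     : ℕ
      rep      : Fin size → A
      rep-P    : ∀ i → P (rep i)
      rep-distinct : ∀ i j → rep i ≈ rep j → i ≡ j
      rep-complete : ∀ k → P (e k) → ∃ λ i → e k ≈ rep i

  private
    represented : ∀ {K} {e : Fin (suc K) → A} (t : Transversal (e ∘ suc)) →
      (P (e zero) → ∃ λ i → e zero ≈ Transversal.rep t i) → Transversal e
    represented t rep₀ = record
      { Transversal t
      ; rep-complete = λ { zero → rep₀ ; (suc k) → rep-complete k }
      }
      where open Transversal t

    adjoin : ∀ {K} {e : Fin (suc K) → A} (t : Transversal (e ∘ suc)) → P (e zero) →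
      ¬ (∃ λ i → e zero ≈ Transversal.rep t i) → Transversal e
    adjoin {e = e} t p e₀≉ = record
      { size         = suc size
      ; rep          = rep′
      ; rep-P        = λ { zero → p ; (suc i) → rep-P i }
      ; rep-distinct = distinct
      ; rep-complete = λ { zero _ → zero , ≈-refl
                         ; (suc k) pk → let (i , ≈i) = rep-complete k pk in suc i , ≈i }
      }
      where
      open Transversal t
      rep′ : Fin (suc size) → A
      rep′ zero    = e zero
      rep′ (suc i) = rep i
      distinct : ∀ i j → rep′ i ≈ rep′ j → i ≡ j
      distinct zero    zero    _ = refl
      distinct zero    (suc j) r = contradiction (j , r) e₀≉
      distinct (suc i) zero    r = contradiction (i , ≈-sym r) e₀≉
      distinct (suc i) (suc j) r = cong suc (rep-distinct i j r)

  transversal : ∀ {K} (e : Fin K → A) → Transversal e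
  transversal {zero}  e = record { size = 0 ; rep = λ () ; rep-P = λ () ; rep-distinct = λ () ; rep-complete = λ () }
  transversal {suc K} e with transversal (e ∘ suc)
  ... | t with P? (e zero) | any? (λ i → e zero ≈? Transversal.rep t i)
  ...   | no ¬p | _       = represented t (λ p → contradiction p ¬p)
  ...   | yes _ | yes ≈i  = represented t (λ _ → ≈i)
  ...   | yes p | no e₀≉ = adjoin t p e₀≉

module _ {q : ℕ} (F : FiniteField q) where

  open FiniteField F using (Carrier; 0≢1; inverse; isCommutativeRing; enumeration)

  ring : CommutativeRing 0ℓ 0ℓ
  ring = record { isCommutativeRing = isCommutativeRing }

  open CommutativeRing ring
    using (_+_; _*_; -_; 0#; 1#; +-identityˡ; +-identityʳ; *-identityˡ; *-identityʳ;
           zeroˡ; zeroʳ; distribˡ; *-comm; *-assoc; +-assoc; +-comm; -‿inverseʳ; -‿inverseˡ; *-commutativeSemigroup)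
  open import Algebra.Properties.Ring (CommutativeRing.ring ring) using (+-cancelʳ; -‿distribˡ-*)
  open import Algebra.Properties.CommutativeSemigroup *-commutativeSemigroup
    using (x∙yz≈y∙xz; x∙yz≈xz∙y; xy∙z≈x∙zy; interchange)
  open import Algebra.Properties.Semiring.Sum (CommutativeRing.semiring ring)
    using (sum; ∑-distrib-+; *-distribˡ-sum; sum-init-last; sum-remove; sum-replicate-zero)

  ∑ : ∀ {n} → (Fin n → Carrier) → Carrier
  ∑ = D.∑ F

  infixr 7 _·_
  _·_ : ∀ {n} → Matrix F n → Vector F n → Vector F n
  _·_ = D._·_ F

  infixl 7 _⊗_
  _⊗_ : ∀ {n} → Matrix F n → Matrix F n → Matrix F n
  _⊗_ = D._⊗_ F

  I : ∀ {n} → Matrix F n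
  I = D.identity F

  0ᵛ : ∀ {n} → Vector F n
  0ᵛ _ = 0#

  *-cancelˡ-≢0 : ∀ {a x y} → a ≢ 0# → a * x ≡ a * y → x ≡ y
  *-cancelˡ-≢0 {a} {x} {y} a≢0 ax≡ay with inverse a a≢0
  ... | a⁻¹ , aa⁻¹≡1 = begin
      x                ≡⟨ *-identityˡ x ⟨
      1# * x           ≡⟨ cong (_* x) a⁻¹a≡1 ⟨
      a⁻¹ * a * x      ≡⟨ *-assoc a⁻¹ a x ⟩
      a⁻¹ * (a * x)    ≡⟨ cong (a⁻¹ *_) ax≡ay ⟩
      a⁻¹ * (a * y)    ≡⟨ *-assoc a⁻¹ a y ⟨
      a⁻¹ * a * y      ≡⟨ cong (_* y) a⁻¹a≡1 ⟩
      1# * y           ≡⟨ *-identityˡ y ⟩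
      y                ∎
    where
    open ≡-Reasoning
    a⁻¹a≡1 = trans (*-comm a⁻¹ a) aa⁻¹≡1

  *-inverseʳ : ∀ s z → s * z + - s * z ≡ 0#
  *-inverseʳ s z = trans (cong (s * z +_) (sym (-‿distribˡ-* s z))) (-‿inverseʳ (s * z))

  +-*-cancel : ∀ x s z → x + - s * z + s * z ≡ x
  +-*-cancel x s z = begin
    x + - s * z + s * z    ≡⟨ +-assoc x (- s * z) (s * z) ⟩
    x + (- s * z + s * z)  ≡⟨ cong (x +_) (trans (+-comm (- s * z) (s * z)) (*-inverseʳ s z)) ⟩
    x + 0#                 ≡⟨ +-identityʳ x ⟩
    x                      ∎
    where open ≡-Reasoning

  *≡1⇒≢0 : ∀ {a b} → a * b ≡ 1# → a ≢ 0#
  *≡1⇒≢0 {a} {b} ab≡1 a≡0 = 0≢1 (trans (sym (zeroˡ b)) (trans (cong (_* b) (sym a≡0)) ab≡1))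

  ∑≡sum : ∀ {n} (f : Fin n → Carrier) → ∑ f ≡ sum f
  ∑≡sum {zero}  f = refl
  ∑≡sum {suc n} f = cong (f zero +_) (∑≡sum (tail f))

  ∑-cong : ∀ {n} {f g : Fin n → Carrier} → (∀ i → f i ≡ g i) → ∑ f ≡ ∑ g
  ∑-cong {zero}  f≗g = refl
  ∑-cong {suc n} f≗g = cong₂ _+_ (f≗g zero) (∑-cong (f≗g ∘ suc))

  ∑-zero : ∀ {n} {f : Fin n → Carrier} → (∀ i → f i ≡ 0#) → ∑ f ≡ 0#
  ∑-zero {n} f≗0 = trans (∑-cong f≗0) (trans (∑≡sum (replicate n 0#)) (sum-replicate-zero n))

  ∑-+ : ∀ {n} (f g : Fin n → Carrier) → ∑ (λ i → f i + g i) ≡ ∑ f + ∑ g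
  ∑-+ f g = trans (∑≡sum (λ i → f i + g i)) (trans (∑-distrib-+ f g) (sym (cong₂ _+_ (∑≡sum f) (∑≡sum g))))

  ∑-*ˡ : ∀ {n} c (f : Fin n → Carrier) → ∑ (λ i → c * f i) ≡ c * ∑ f
  ∑-*ˡ c f = trans (∑≡sum (λ i → c * f i)) (trans (sym (*-distribˡ-sum c f)) (cong (c *_) (sym (∑≡sum f))))

  ∑-init-last : ∀ {n} (f : Fin (suc n) → Carrier) → ∑ f ≡ ∑ (init f) + last f
  ∑-init-last f = trans (∑≡sum f) (trans (sum-init-last f) (cong (_+ last f) (sym (∑≡sum (init f)))))

  ∑-δ : ∀ {n} (f : Fin n → Carrier) i → (∀ j → j ≢ i → f j ≡ 0#) → ∑ f ≡ f i
  ∑-δ {suc n} f i f≡0 = begin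
    ∑ f                                     ≡⟨ ∑≡sum f ⟩
    sum f                                   ≡⟨ sum-remove {i = i} f ⟩
    f i + sum (f ∘ Fin.punchIn i)           ≡⟨ cong (f i +_) (∑≡sum (f ∘ Fin.punchIn i)) ⟨
    f i + ∑ (f ∘ Fin.punchIn i)             ≡⟨ cong (f i +_) (∑-zero λ j → f≡0 _ (punchInᵢ≢i i j)) ⟩
    f i + 0#                                ≡⟨ +-identityʳ (f i) ⟩
    f i                                     ∎
    where open ≡-Reasoning

  ·-cong : ∀ {n} (A : Matrix F n) {x y : Vector F n} → (∀ j → x j ≡ y j) → ∀ i → (A · x) i ≡ (A · y) i
  ·-cong A x≗y i = ∑-cong λ j → cong (A i j *_) (x≗y j)

  ·-zero : ∀ {n} (A : Matrix F n) {x : Vector F n} → (∀ j → x j ≡ 0#) → ∀ i → (A · x) i ≡ 0#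
  ·-zero A x≗0 i = ∑-zero λ j → trans (cong (A i j *_) (x≗0 j)) (zeroʳ (A i j))

  ·-+* : ∀ {n} (A : Matrix F n) (x : Vector F n) s y i → (A · (λ j → x j + s * y j)) i ≡ (A · x) i + s * (A · y) i
  ·-+* A x s y i = begin
    ∑ (λ j → A i j * (x j + s * y j))                 ≡⟨ ∑-cong (λ j → distribˡ (A i j) (x j) (s * y j)) ⟩
    ∑ (λ j → A i j * x j + A i j * (s * y j))         ≡⟨ ∑-+ (λ j → A i j * x j) (λ j → A i j * (s * y j)) ⟩
    (A · x) i + ∑ (λ j → A i j * (s * y j))           ≡⟨ cong ((A · x) i +_) (∑-cong λ j → x∙yz≈y∙xz (A i j) s (y j)) ⟩
    (A · x) i + ∑ (λ j → s * (A i j * y j))           ≡⟨ cong ((A · x) i +_) (∑-*ˡ s (λ j → A i j * y j)) ⟩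
    (A · x) i + s * (A · y) i                         ∎
    where open ≡-Reasoning

  I-diag : ∀ {n} (i : Fin n) → I i i ≡ 1#
  I-diag i with i Fin.≟ i
  ... | yes _   = refl
  ... | no  i≢i = contradiction refl i≢i

  I-offdiag : ∀ {n} {i j : Fin n} → i ≢ j → I i j ≡ 0#
  I-offdiag {i = i} {j} i≢j with i Fin.≟ j
  ... | yes i≡j = contradiction i≡j i≢j
  ... | no  _   = refl

  I-injective : ∀ {m n} {f : Fin m → Fin n} → (∀ {i j} → f i ≡ f j → i ≡ j) → ∀ i j → I (f i) (f j) ≡ I i j
  I-injective {f = f} f-inj i j with i Fin.≟ j
  ... | yes refl = I-diag (f i)
  ... | no  i≢j  = I-offdiag (i≢j ∘ f-inj)

  I·x : ∀ {n} (x : Vector F n) i → (I · x) i ≡ x i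
  I·x x i = trans (∑-δ _ i λ j j≢i → trans (cong (_* x j) (I-offdiag (j≢i ∘ sym))) (zeroˡ (x j)))
                  (trans (cong (_* x i) (I-diag i)) (*-identityˡ (x i)))

  UT-I : ∀ {n} → UpperTriangular F (I {n})
  UT-I i j j<i = I-offdiag λ i≡j → <-irrefl (cong toℕ (sym i≡j)) j<i

  tailM : ∀ {n} → Matrix F (suc n) → Matrix F n
  tailM A i j = A (suc i) (suc j)

  UT-tailM : ∀ {n} {A : Matrix F (suc n)} → UpperTriangular F A → UpperTriangular F (tailM A)
  UT-tailM ut i j j<i = ut (suc i) (suc j) (ℕ.s≤s j<i)

  ·-suc : ∀ {n} {A : Matrix F (suc n)} → UpperTriangular F A → ∀ x i → (A · x) (suc i) ≡ (tailM A · tail x) i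
  ·-suc {A = A} ut x i = trans (cong (_+ (tailM A · tail x) i) (trans (cong (_* x zero) (ut (suc i) zero ℕ.z<s)) (zeroˡ (x zero))))
                                (+-identityˡ _)

  ·-last : ∀ {n} {A : Matrix F (suc n)} → UpperTriangular F A → ∀ x → last (A · x) ≡ last (last A) * last x
  ·-last {n} {A} ut x = begin
    last (A · x)                                       ≡⟨ ∑-init-last (λ j → A (fromℕ n) j * x j) ⟩
    ∑ (λ j → A (fromℕ n) (inject₁ j) * x (inject₁ j)) + last (last A) * last x
      ≡⟨ cong (_+ _) (∑-zero λ j → trans (cong (_* _) (ut _ _ (inject₁<fromℕ j))) (zeroˡ _)) ⟩
    0# + last (last A) * last x                        ≡⟨ +-identityˡ _ ⟩
    last (last A) * last x                             ∎
    where open ≡-Reasoning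

  ⊗-tailM : ∀ {n} {A B : Matrix F (suc n)} → (∀ i → A (suc i) zero ≡ 0#) →
            ∀ i k → (tailM A ⊗ tailM B) i k ≡ (A ⊗ B) (suc i) (suc k)
  ⊗-tailM {A = A} {B} A₀≡0 i k =
    sym (trans (cong (_+ (tailM A ⊗ tailM B) i k) (trans (cong (_* B zero (suc k)) (A₀≡0 i)) (zeroˡ _))) (+-identityˡ _))

  UT-inverse : ∀ {n} {A B : Matrix F n} → UpperTriangular F A →
    (∀ i j → (A ⊗ B) i j ≡ I i j) → (∀ i j → (B ⊗ A) i j ≡ I i j) →
    (∀ i → A i i ≢ 0#) × UpperTriangular F B
  UT-inverse {zero}              ut AB≡I BA≡I = (λ ()) , λ ()
  UT-inverse {suc n} {A = A} {B} ut AB≡I BA≡I = diag≢0 , utB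
    where
    a = A zero zero
    BA-col₀ : ∀ i → (B ⊗ A) i zero ≡ B i zero * a
    BA-col₀ i = trans (cong (B i zero * a +_) (∑-zero λ j → trans (cong (B i (suc j) *_) (ut (suc j) zero ℕ.z<s)) (zeroʳ _)))
                      (+-identityʳ _)
    a≢0 : a ≢ 0#
    a≢0 = *≡1⇒≢0 (trans (*-comm a (B zero zero)) (trans (sym (BA-col₀ zero)) (BA≡I zero zero)))
    B-col₀ : ∀ i → B (suc i) zero ≡ 0#
    B-col₀ i = *-cancelˡ-≢0 a≢0 (trans (*-comm a _) (trans (sym (BA-col₀ (suc i))) (trans (BA≡I (suc i) zero) (sym (zeroʳ a)))))
    ih = UT-inverse (UT-tailM ut)
      (λ i k → trans (⊗-tailM {A = A} {B} (λ i → ut (suc i) zero ℕ.z<s) i k)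
                     (trans (AB≡I (suc i) (suc k)) (I-injective suc-injective i k)))
      (λ i k → trans (⊗-tailM {A = B} {A} B-col₀ i k) (trans (BA≡I (suc i) (suc k)) (I-injective suc-injective i k)))
    diag≢0 : ∀ i → A i i ≢ 0#
    diag≢0 zero    = a≢0
    diag≢0 (suc i) = proj₁ ih i
    utB : UpperTriangular F B
    utB (suc i) zero    _         = B-col₀ i
    utB (suc i) (suc j) (ℕ.s≤s j<i) = proj₂ ih i j j<i

  diagonal≢0 : ∀ {n} {A : Matrix F n} → InBorel F A → ∀ i → A i i ≢ 0#
  diagonal≢0 (ut , _ , AB≡I , BA≡I) = proj₁ (UT-inverse ut AB≡I BA≡I)

  last≡0 : ∀ {n} {A : Matrix F (suc n)} → InBorel F A → ∀ x → last (A · x) ≡ 0# → last x ≡ 0#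
  last≡0 {n} {A} borel x Ax≡0 =
    *-cancelˡ-≢0 (diagonal≢0 borel (fromℕ n)) (trans (sym (·-last (proj₁ borel) x)) (trans Ax≡0 (sym (zeroʳ _))))

  -- bordered A u = [[A , u] , [0 , 1]]
  bordered : ∀ {m} → Matrix F m → Vector F m → Matrix F (suc m)
  bordered A u = snoc (λ i → snoc (A i) (u i)) (snoc (λ _ → 0#) 1#)

  module _ {m} (A : Matrix F m) (u : Vector F m) where

    bordered-init-init : ∀ i j → bordered A u (inject₁ i) (inject₁ j) ≡ A i j
    bordered-init-init i j = trans (cong (_$ inject₁ j) (init-snoc (λ i → snoc (A i) (u i)) _ i)) (init-snoc (A i) (u i) j)

    bordered-init-last : ∀ i → bordered A u (inject₁ i) (fromℕ m) ≡ u i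
    bordered-init-last i = trans (cong (_$ fromℕ m) (init-snoc (λ i → snoc (A i) (u i)) _ i)) (last-snoc (A i) (u i))

    bordered-last-init : ∀ j → bordered A u (fromℕ m) (inject₁ j) ≡ 0#
    bordered-last-init j = trans (cong (_$ inject₁ j) (last-snoc (λ i → snoc (A i) (u i)) _)) (init-snoc _ 1# j)

    bordered-last-last : bordered A u (fromℕ m) (fromℕ m) ≡ 1#
    bordered-last-last = trans (cong (_$ fromℕ m) (last-snoc (λ i → snoc (A i) (u i)) _)) (last-snoc {m = m} _ 1#)

    ·-bordered-init : ∀ x i → (bordered A u · x) (inject₁ i) ≡ (A · init x) i + u i * last x
    ·-bordered-init x i = trans (∑-init-last (λ j → bordered A u (inject₁ i) j * x j))
      (cong₂ _+_ (∑-cong λ j → cong (_* x (inject₁ j)) (bordered-init-init i j)) (cong (_* last x) (bordered-init-last i)))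

    ·-bordered-last : ∀ x → last (bordered A u · x) ≡ last x
    ·-bordered-last x = begin
      last (bordered A u · x)                                            ≡⟨ ∑-init-last (λ j → bordered A u (fromℕ m) j * x j) ⟩
      ∑ (λ j → bordered A u (fromℕ m) (inject₁ j) * x (inject₁ j)) + bordered A u (fromℕ m) (fromℕ m) * last x
        ≡⟨ cong₂ _+_ (∑-zero λ j → trans (cong (_* x (inject₁ j)) (bordered-last-init j)) (zeroˡ _))
                     (trans (cong (_* last x) bordered-last-last) (*-identityˡ (last x))) ⟩
      0# + last x                                                        ≡⟨ +-identityˡ (last x) ⟩
      last x                                                             ∎
      where open ≡-Reasoning

    UT-bordered : UpperTriangular F A → UpperTriangular F (bordered A u)
    UT-bordered ut i j j<i with view i | view j
    ... | ‵inject₁ i′ | ‵inject₁ j′ =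
      trans (bordered-init-init i′ j′) (ut i′ j′ (subst₂ ℕ._<_ (toℕ-inject₁ j′) (toℕ-inject₁ i′) j<i))
    ... | ‵inject₁ i′ | ‵fromℕ     = contradiction j<i (<-asym (inject₁<fromℕ i′))
    ... | ‵fromℕ     | ‵inject₁ j′ = bordered-last-init j′
    ... | ‵fromℕ     | ‵fromℕ     = contradiction j<i (<-irrefl refl)

  ⊗-bordered : ∀ {m} (A B : Matrix F m) (u v : Vector F m) → (∀ i k → (A ⊗ B) i k ≡ I i k) →
    (∀ i → (A · v) i + u i ≡ 0#) → ∀ k l → (bordered A u ⊗ bordered B v) k l ≡ I k l
  -- (X ⊗ Y) k l is by definition (X · column l of Y) k.
  ⊗-bordered {m} A B u v AB≡I Av+u≡0 k l with view k | view l
  ... | ‵inject₁ i | ‵inject₁ j = begin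
    (bordered A u · column (inject₁ j)) (inject₁ i)                ≡⟨ ·-bordered-init A u (column (inject₁ j)) i ⟩
    (A · init (column (inject₁ j))) i + u i * bordered B v (fromℕ m) (inject₁ j)
      ≡⟨ cong₂ _+_ (·-cong A (λ k → bordered-init-init B v k j) i)
                   (trans (cong (u i *_) (bordered-last-init B v j)) (zeroʳ (u i))) ⟩
    (A ⊗ B) i j + 0#                                                ≡⟨ trans (+-identityʳ _) (AB≡I i j) ⟩
    I i j                                                           ≡⟨ I-injective inject₁-injective i j ⟨
    I (inject₁ i) (inject₁ j)                                       ∎
    where open ≡-Reasoning
          column = λ l k → bordered B v k l
  ... | ‵inject₁ i | ‵fromℕ = begin
    (bordered A u · column) (inject₁ i)                             ≡⟨ ·-bordered-init A u column i ⟩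
    (A · init column) i + u i * bordered B v (fromℕ m) (fromℕ m)
      ≡⟨ cong₂ _+_ (·-cong A (bordered-init-last B v) i) (trans (cong (u i *_) (bordered-last-last B v)) (*-identityʳ (u i))) ⟩
    (A · v) i + u i                                                 ≡⟨ Av+u≡0 i ⟩
    0#                                          ≡⟨ I-offdiag {i = inject₁ i} {fromℕ m} (fromℕ≢inject₁ ∘ sym) ⟨
    I (inject₁ i) (fromℕ m)                                         ∎
    where open ≡-Reasoning
          column = λ k → bordered B v k (fromℕ m)
  ... | ‵fromℕ | ‵inject₁ j =
    trans (·-bordered-last A u (λ k → bordered B v k (inject₁ j)))
          (trans (bordered-last-init B v j) (sym (I-offdiag {i = fromℕ m} {inject₁ j} fromℕ≢inject₁)))
  ... | ‵fromℕ | ‵fromℕ =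
    trans (·-bordered-last A u (λ k → bordered B v k (fromℕ m)))
          (trans (bordered-last-last B v) (sym (I-diag (fromℕ m))))

  InBorel-bordered0 : ∀ {m} {A : Matrix F m} → InBorel F A → InBorel F (bordered A 0ᵛ)
  InBorel-bordered0 {A = A} (ut , B , AB≡I , BA≡I) =
    UT-bordered A 0ᵛ ut , bordered B 0ᵛ ,
    ⊗-bordered A B _ _ AB≡I (λ i → trans (+-identityʳ _) (·-zero A (λ _ → refl) i)) ,
    ⊗-bordered B A _ _ BA≡I (λ i → trans (+-identityʳ _) (·-zero B (λ _ → refl) i))

  InBorel-borderedI : ∀ {m} (u : Vector F m) → InBorel F (bordered I u)
  InBorel-borderedI u =
    UT-bordered I u UT-I , bordered I (-_ ∘ u) ,
    ⊗-bordered I I u (-_ ∘ u) I⊗I≡I (λ i → trans (cong (_+ u i) (I·x (-_ ∘ u) i)) (-‿inverseˡ (u i))) ,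
    ⊗-bordered I I (-_ ∘ u) u I⊗I≡I (λ i → trans (cong (_+ - u i) (I·x u i)) (-‿inverseʳ (u i)))
    where I⊗I≡I = λ i k → I·x (λ j → I j k) i

  topLeft : ∀ {m} → Matrix F (suc m) → Matrix F m
  topLeft A i j = A (inject₁ i) (inject₁ j)

  ·-topLeft : ∀ {m} (A : Matrix F (suc m)) x → last x ≡ 0# → ∀ i → (A · x) (inject₁ i) ≡ (topLeft A · init x) i
  ·-topLeft {m} A x x≡0 i = trans (∑-init-last (λ j → A (inject₁ i) j * x j))
    (trans (cong ((topLeft A · init x) i +_) (trans (cong (A (inject₁ i) (fromℕ m) *_) x≡0) (zeroʳ _))) (+-identityʳ _))

  InBorel-topLeft : ∀ {m} {A : Matrix F (suc m)} → InBorel F A → InBorel F (topLeft A)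
  InBorel-topLeft {A = A} (ut , B , AB≡I , BA≡I) =
    (λ i j j<i → ut _ _ (subst₂ ℕ._<_ (sym (toℕ-inject₁ j)) (sym (toℕ-inject₁ i)) j<i)) , topLeft B ,
    ⊗-topLeft A B utB AB≡I , ⊗-topLeft B A ut BA≡I
    where
    utB = proj₂ (UT-inverse ut AB≡I BA≡I)
    ⊗-topLeft : ∀ X Y → UpperTriangular F Y → (∀ i j → (X ⊗ Y) i j ≡ I i j) →
                ∀ i k → (topLeft X ⊗ topLeft Y) i k ≡ I i k
    ⊗-topLeft X Y utY XY≡I i k = trans (sym (·-topLeft X (λ j → Y j (inject₁ k)) (utY _ _ (inject₁<fromℕ k)) i))
                                       (trans (XY≡I _ _) (I-injective inject₁-injective i k))

  E : ∀ {n} → Subset n → VSubset F n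
  E = D.E F

  infixr 7 _▸_
  _▸_ : ∀ {n} → Matrix F n → VSubset F n → VSubset F n
  _▸_ = D._▸_ F

  infix 4 _≐_ _⊑_
  _≐_ _⊑_ : ∀ {n} → VSubset F n → VSubset F n → Set
  _≐_ = D._≐_ F
  _⊑_ = D._⊑_ F

  E-resp : ∀ {n} (ρ : Subset n) {x y : Vector F n} → (∀ j → x j ≡ y j) → E ρ x → E ρ y
  E-resp ρ x≗y x∈E j j∉ρ = trans (sym (x≗y j)) (x∈E j j∉ρ)

  ▸-resp : ∀ {n} (A : Matrix F n) S {v w : Vector F n} → (∀ i → v i ≡ w i) → (A ▸ S) v → (A ▸ S) w
  ▸-resp A S v≗w (x , x∈S , Ax≡v) = x , x∈S , λ i → trans (Ax≡v i) (v≗w i)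

  ▸E-+* : ∀ {n} (A : Matrix F n) (ρ : Subset n) {v w} →
          (A ▸ E ρ) v → (A ▸ E ρ) w → ∀ s → (A ▸ E ρ) (λ i → v i + s * w i)
  ▸E-+* A ρ (x , x∈E , Ax≡v) (y , y∈E , Ay≡w) s =
    (λ j → x j + s * y j) ,
    (λ j j∉ρ → trans (cong₂ _+_ (x∈E j j∉ρ) (trans (cong (s *_) (y∈E j j∉ρ)) (zeroʳ s))) (+-identityˡ 0#)) ,
    (λ i → trans (·-+* A x s y i) (cong₂ _+_ (Ax≡v i) (cong (s *_) (Ay≡w i))))

  -- Back substitution: the lower rows determine the tail, then the first row the first coordinate.
  UT-injectiveOn : ∀ {n} {A : Matrix F n} → UpperTriangular F A → (∀ i → A i i ≢ 0#) → ∀ (ρ : Subset n) {x y} →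
    E ρ x → E ρ y → (∀ j → j ∈ ρ → (A · x) j ≡ (A · y) j) → ∀ j → x j ≡ y j
  UT-injectiveOn {suc n} {A} ut diag≢0 ρ@(_ ∷ ρ′) {x} {y} x∈E y∈E Ax≡Ay = x≗y
    where
    tail≡ : ∀ j → x (suc j) ≡ y (suc j)
    tail≡ = UT-injectiveOn (UT-tailM ut) (diag≢0 ∘ suc) ρ′
      (λ j j∉ρ′ → x∈E (suc j) (j∉ρ′ ∘ drop-there)) (λ j j∉ρ′ → y∈E (suc j) (j∉ρ′ ∘ drop-there))
      (λ j j∈ρ′ → trans (sym (·-suc ut x j)) (trans (Ax≡Ay (suc j) (there j∈ρ′)) (·-suc ut y j)))
    head≡ : x zero ≡ y zero
    head≡ with zero ∈? ρ
    ... | no  0∉ρ = trans (x∈E zero 0∉ρ) (sym (y∈E zero 0∉ρ))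
    ... | yes 0∈ρ = *-cancelˡ-≢0 (diag≢0 zero) (+-cancelʳ (∑ (λ j → A zero (suc j) * x (suc j))) _ _
      (trans (Ax≡Ay zero 0∈ρ) (cong (A zero zero * y zero +_) (∑-cong λ j → cong (A zero (suc j) *_) (sym (tail≡ j))))))
    x≗y : ∀ j → x j ≡ y j
    x≗y zero    = head≡
    x≗y (suc j) = tail≡ j

  E⊑▸E⇒⊆ : ∀ {n} {A : Matrix F n} {τ ρ : Subset n} → InBorel F A → E τ ⊑ A ▸ E ρ → τ ⊆ ρ
  E⊑▸E⇒⊆ {A = A} {τ} {ρ} borel E⊑ {j} j∈τ with j ∈? ρ | E⊑ eⱼ eⱼ∈E
    where
    eⱼ = λ k → I k j
    eⱼ∈E : E τ eⱼ
    eⱼ∈E k k∉τ = I-offdiag λ k≡j → k∉τ (subst (_∈ τ) (sym k≡j) j∈τ)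
  ... | yes j∈ρ | _ = j∈ρ
  ... | no  j∉ρ | x , x∈E , Ax≡eⱼ = contradiction 1≡0 (0≢1 ∘ sym)
    where
    x≗0 = UT-injectiveOn (proj₁ borel) (diagonal≢0 borel) ρ x∈E (λ _ _ → refl)
            λ k k∈ρ → trans (Ax≡eⱼ k) (trans (I-offdiag λ k≡j → j∉ρ (subst (_∈ ρ) k≡j k∈ρ))
                                              (sym (·-zero A (λ _ → refl) k)))
    1≡0 = trans (sym (I-diag j)) (trans (sym (Ax≡eⱼ j)) (·-zero A x≗0 j))

  restrict : ∀ {n} → Subset n → Vector F n → Vector F n
  restrict ρ v k with k ∈? ρ
  ... | yes _ = v k
  ... | no  _ = 0#

  restrict-∈ : ∀ {n} (ρ : Subset n) v {k} → k ∈ ρ → restrict ρ v k ≡ v k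
  restrict-∈ ρ v {k} k∈ρ with k ∈? ρ
  ... | yes _   = refl
  ... | no  k∉ρ = contradiction k∈ρ k∉ρ

  restrict-∉ : ∀ {n} (ρ : Subset n) v {k} → k ∉ ρ → restrict ρ v k ≡ 0#
  restrict-∉ ρ v {k} k∉ρ with k ∈? ρ
  ... | yes k∈ρ = contradiction k∈ρ k∉ρ
  ... | no  _   = refl

  E⊑▸E⇒▸E⊑E : ∀ {n} {A : Matrix F n} {ρ : Subset n} → InBorel F A → E ρ ⊑ A ▸ E ρ → A ▸ E ρ ⊑ E ρ
  -- v = A x and its projection A x′ onto E(ρ) agree on ρ, so x = x′ by back substitution, and v lies in E(ρ).
  E⊑▸E⇒▸E⊑E {A = A} {ρ} borel E⊑ v (x , x∈E , Ax≡v) k k∉ρ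
    with E⊑ (restrict ρ v) (λ _ → restrict-∉ ρ v)
  ... | x′ , x′∈E , Ax′≡v|ρ = begin
    v k                ≡⟨ Ax≡v k ⟨
    (A · x) k          ≡⟨ ·-cong A x≗x′ k ⟩
    (A · x′) k         ≡⟨ Ax′≡v|ρ k ⟩
    restrict ρ v k     ≡⟨ restrict-∉ ρ v k∉ρ ⟩
    0#                 ∎
    where
    open ≡-Reasoning
    x≗x′ = UT-injectiveOn (proj₁ borel) (diagonal≢0 borel) ρ x∈E x′∈E
             λ j j∈ρ → trans (Ax≡v j) (trans (sym (restrict-∈ ρ v j∈ρ)) (sym (Ax′≡v|ρ j)))

  E-snoc : ∀ {m} {ρ : Subset m} {b v c} → E ρ v → (b ≡ outside → c ≡ 0#) → E (ρ ∷ʳ b) (snoc v c)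
  E-snoc {ρ = ρ} {v = v} {c} v∈E c≡0 k k∉ with view k
  ... | ‵inject₁ j = trans (init-snoc v c j) (v∈E j (k∉ ∘ inject₁∈∷ʳ⁺))
  ... | ‵fromℕ     = trans (last-snoc v c) (c≡0 (fromℕ∉∷ʳ⇒outside ρ k∉))

  E-init : ∀ {m} {ρ : Subset m} {b w} → E (ρ ∷ʳ b) w → E ρ (init w)
  E-init w∈E j j∉ρ = w∈E (inject₁ j) (j∉ρ ∘ inject₁∈∷ʳ⁻)

  E-last : ∀ {m} {ρ : Subset m} {w} → E (ρ ∷ʳ outside) w → last w ≡ 0#
  E-last {ρ = ρ} w∈E = w∈E _ (fromℕ∉∷ʳoutside ρ)

  Incident : ∀ {n} → Subset n → Subset n → VSubset F n → Set
  Incident τ π S = InOrbitOfE F π S × E τ ⊑ S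

  ≐-refl : ∀ {n} {S : VSubset F n} → S ≐ S
  ≐-refl v = (λ s → s) , (λ s → s)

  ≐-sym : ∀ {n} {S T : VSubset F n} → S ≐ T → T ≐ S
  ≐-sym S≐T v = swap (S≐T v)

  ≐-trans : ∀ {n} {S T U : VSubset F n} → S ≐ T → T ≐ U → S ≐ U
  ≐-trans S≐T T≐U v = proj₁ (T≐U v) ∘ proj₁ (S≐T v) , proj₂ (S≐T v) ∘ proj₂ (T≐U v)

  orbit-resp : ∀ {n} {π : Subset n} {T} → InOrbitOfE F π T → ∀ {v w} → (∀ i → v i ≡ w i) → T v → T w
  orbit-resp {π = π} (A , _ , T≐) v≗w = proj₂ (T≐ _) ∘ ▸-resp A (E π) v≗w ∘ proj₁ (T≐ _)

  orbit-+* : ∀ {n} {π : Subset n} {T} → InOrbitOfE F π T → ∀ {v w} → T v → T w → ∀ s → T (λ i → v i + s * w i)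
  orbit-+* {π = π} (A , _ , T≐) v∈T w∈T s = proj₂ (T≐ _) (▸E-+* A π (proj₁ (T≐ _) v∈T) (proj₁ (T≐ _) w∈T) s)

  IncidenceCount-zero : ∀ {n} {τ π : Subset n} → ¬ τ ⊆ π → IncidenceCount F n τ π 0
  IncidenceCount-zero τ⊈π = (λ ()) , (λ ()) , (λ ()) , λ T (A , borel , T≐) E⊑T →
    contradiction (λ {x} → E⊑▸E⇒⊆ borel (λ v → proj₁ (T≐ v) ∘ E⊑T v) {x}) τ⊈π

  record IncidenceCorrespondence {a b} (τa πa : Subset a) (τb πb : Subset b) : Set₁ where
    field
      to            : VSubset F a → VSubset F b
      from          : VSubset F b → VSubset F a
      to-incident   : ∀ {S} → Incident τa πa S → Incident τb πb (to S)
      from-incident : ∀ {T} → Incident τb πb T → Incident τa πa (from T)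
      to-cong       : ∀ {S S′} → S ≐ S′ → to S ≐ to S′
      from-cong     : ∀ {T T′} → T ≐ T′ → from T ≐ from T′
      from∘to       : ∀ {S} → Incident τa πa S → from (to S) ≐ S
      to∘from       : ∀ {T} → Incident τb πb T → to (from T) ≐ T

  IncidenceCount-transport : ∀ {a b} {τa πa : Subset a} {τb πb : Subset b} {N} →
    IncidenceCorrespondence τa πa τb πb → IncidenceCount F a τa πa N → IncidenceCount F b τb πb N
  IncidenceCount-transport c (S , S-incident , S-distinct , S-complete) =
    to ∘ S , to-incident ∘ S-incident ,
    (λ i j toSᵢ≐toSⱼ → S-distinct i j
      (≐-trans (≐-sym (from∘to (S-incident i))) (≐-trans (from-cong toSᵢ≐toSⱼ) (from∘to (S-incident j))))) ,
    λ T T-orbit E⊑T → let (i , fromT≐Sᵢ) = S-complete (from T) (proj₁ (from-incident (T-orbit , E⊑T)))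
                                                       (proj₂ (from-incident (T-orbit , E⊑T)))
                       in i , ≐-trans (≐-sym (to∘from (T-orbit , E⊑T))) (to-cong fromT≐Sᵢ)
    where open IncidenceCorrespondence c

  -- Parts (ii) and (iii): n in both τ and π, or in neither

  -- lift b S is S × F if n ∈ π, and S × {0} if n ∉ π.
  lift : ∀ {m} → Side → VSubset F m → VSubset F (suc m)
  lift b S w = S (init w) × (b ≡ outside → last w ≡ 0#)

  slice : ∀ {m} → VSubset F (suc m) → VSubset F m
  slice T v = T (snoc v 0#)

  eₙ : ∀ {m} → Vector F (suc m)
  eₙ = snoc 0ᵛ 1#

  snoc+*eₙ : ∀ {m} (v : Vector F m) c s i → snoc v c i + s * eₙ i ≡ snoc v (c + s) i
  snoc+*eₙ {m} v c s i with view i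
  ... | ‵inject₁ j = begin
    snoc v c (inject₁ j) + s * eₙ (inject₁ j)
      ≡⟨ cong₂ _+_ (init-snoc v c j) (trans (cong (s *_) (init-snoc 0ᵛ 1# j)) (zeroʳ s)) ⟩
    v j + 0#                                  ≡⟨ +-identityʳ (v j) ⟩
    v j                                       ≡⟨ init-snoc v (c + s) j ⟨
    snoc v (c + s) (inject₁ j)                ∎
    where open ≡-Reasoning
  ... | ‵fromℕ = begin
    last (snoc v c) + s * last (eₙ {m})
      ≡⟨ cong₂ _+_ (last-snoc v c) (trans (cong (s *_) (last-snoc {m = m} 0ᵛ 1#)) (*-identityʳ s)) ⟩
    c + s                                     ≡⟨ last-snoc {m = m} v (c + s) ⟨
    last (snoc v (c + s))                     ∎
    where open ≡-Reasoning

  ·-bordered0-init : ∀ {m} (A : Matrix F m) x i → (bordered A 0ᵛ · x) (inject₁ i) ≡ (A · init x) i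
  ·-bordered0-init A x i = trans (·-bordered-init A 0ᵛ x i) (trans (cong ((A · init x) i +_) (zeroˡ (last x))) (+-identityʳ _))

  bordered0▸E : ∀ {m} (A : Matrix F m) π b → bordered A 0ᵛ ▸ E (π ∷ʳ b) ≐ lift b (A ▸ E π)
  bordered0▸E A π b w = to , from
    where
    to : (bordered A 0ᵛ ▸ E (π ∷ʳ b)) w → lift b (A ▸ E π) w
    to (x , x∈E , Ax≡w) =
      (init x , E-init x∈E , λ i → trans (sym (·-bordered0-init A x i)) (Ax≡w (inject₁ i))) ,
      λ { refl → trans (sym (Ax≡w _)) (trans (·-bordered-last A 0ᵛ x) (E-last x∈E)) }
    from : lift b (A ▸ E π) w → (bordered A 0ᵛ ▸ E (π ∷ʳ b)) w
    from ((y , y∈E , Ay≡w) , w≡0) = snoc y (last w) , E-snoc y∈E w≡0 , action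
      where
      action : ∀ i → (bordered A 0ᵛ · snoc y (last w)) i ≡ w i
      action i with view i
      ... | ‵inject₁ j = trans (·-bordered0-init A (snoc y (last w)) j) (trans (·-cong A (init-snoc y (last w)) j) (Ay≡w j))
      ... | ‵fromℕ     = trans (·-bordered-last A 0ᵛ (snoc y (last w))) (last-snoc y (last w))

  topLeft▸E : ∀ {m} {A : Matrix F (suc m)} → InBorel F A → ∀ π b → slice (A ▸ E (π ∷ʳ b)) ≐ topLeft A ▸ E π
  topLeft▸E {A = A} borel π b v = to , from
    where
    to : slice (A ▸ E (π ∷ʳ b)) v → (topLeft A ▸ E π) v
    to (x , x∈E , Ax≡v) = init x , E-init x∈E ,
      λ i → trans (sym (·-topLeft A x x≡0 i)) (trans (Ax≡v (inject₁ i)) (init-snoc v 0# i))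
      where x≡0 = last≡0 borel x (trans (Ax≡v _) (last-snoc v 0#))
    from : (topLeft A ▸ E π) v → slice (A ▸ E (π ∷ʳ b)) v
    from (y , y∈E , Ay≡v) = snoc y 0# , E-snoc y∈E (λ _ → refl) , action
      where
      action : ∀ i → (A · snoc y 0#) i ≡ snoc v 0# i
      action i with view i
      ... | ‵inject₁ j = trans (·-topLeft A (snoc y 0#) (last-snoc y 0#) j)
                           (trans (·-cong (topLeft A) (init-snoc y 0#) j) (trans (Ay≡v j) (sym (init-snoc v 0# j))))
      ... | ‵fromℕ     = trans (·-last (proj₁ borel) (snoc y 0#))
                           (trans (cong (last (last A) *_) (last-snoc y 0#)) (trans (zeroʳ _) (sym (last-snoc v 0#))))

  lift-cong : ∀ {m} b {S S′ : VSubset F m} → S ≐ S′ → lift b S ≐ lift b S′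
  lift-cong b S≐S′ w = map₁ (proj₁ (S≐S′ _)) , map₁ (proj₂ (S≐S′ _))

  lift-slice : ∀ {m} {τ π : Subset m} b {T} → Incident (τ ∷ʳ b) (π ∷ʳ b) T → lift b (slice T) ≐ T
  -- If n ∉ π then T lies in the hyperplane xₙ = 0; if n ∈ τ then eₙ ∈ T and w − wₙ eₙ ∈ slice T.
  lift-slice outside {T} (T-orbit@(_ , borel , T≐) , _) w = to , from
    where
    to : lift outside (slice T) w → T w
    to (t , w≡0) = orbit-resp T-orbit (λ i → trans (cong (λ c → snoc (init w) c i) (sym (w≡0 refl))) (snoc-init-last w i)) t
    from : T w → lift outside (slice T) w
    from t with proj₁ (T≐ w) t
    ... | x , x∈E , Ax≡w = orbit-resp T-orbit (λ i → trans (sym (snoc-init-last w i)) (cong (λ c → snoc (init w) c i) w≡0)) t ,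
                           λ _ → w≡0
      where w≡0 = trans (sym (Ax≡w _)) (trans (·-last (proj₁ borel) x) (trans (cong (_ *_) (E-last x∈E)) (zeroʳ _)))
  lift-slice inside {T} (T-orbit , E⊑T) w = to , from
    where
    eₙ∈T : T eₙ
    eₙ∈T = E⊑T eₙ (E-snoc (λ _ _ → refl) λ ())
    to : lift inside (slice T) w → T w
    to (t , _) = orbit-resp T-orbit
      (λ i → trans (snoc+*eₙ (init w) 0# (last w) i)
                   (trans (cong (λ c → snoc (init w) c i) (+-identityˡ (last w))) (snoc-init-last w i)))
      (orbit-+* T-orbit t eₙ∈T (last w))
    from : T w → lift inside (slice T) w
    from t = orbit-resp T-orbit
      (λ i → trans (snoc+*eₙ (init w) (last w) (- last w) i) (cong (λ c → snoc (init w) c i) (-‿inverseʳ (last w))))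
      (orbit-+* T-orbit (orbit-resp T-orbit (sym ∘ snoc-init-last w) t) eₙ∈T (- last w)) ,
      λ ()

  extension : ∀ {m} (τ π : Subset m) b → IncidenceCorrespondence τ π (τ ∷ʳ b) (π ∷ʳ b)
  extension τ π b = record
    { to            = lift b
    ; from          = slice
    ; to-incident   = λ { ((A , borel , S≐) , E⊑S) →
        (bordered A 0ᵛ , InBorel-bordered0 borel , ≐-trans (lift-cong b S≐) (≐-sym (bordered0▸E A π b))) ,
        λ w w∈E → E⊑S _ (E-init w∈E) , λ { refl → E-last w∈E } }
    ; from-incident = λ { ((A , borel , T≐) , E⊑T) →
        (topLeft A , InBorel-topLeft borel , ≐-trans (T≐ ∘ λ v → snoc v 0#) (topLeft▸E borel π b)) ,
        λ v v∈E → E⊑T _ (E-snoc v∈E λ _ → refl) }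
    ; to-cong       = lift-cong b
    ; from-cong     = λ T≐T′ → T≐T′ ∘ λ v → snoc v 0#
    ; from∘to       = λ { (S-orbit , _) v →
        orbit-resp S-orbit (init-snoc v 0#) ∘ proj₁ ,
        λ s → orbit-resp S-orbit (sym ∘ init-snoc v 0#) s , λ _ → last-snoc v 0# }
    ; to∘from       = lift-slice b
    }

  -- Part (i): π = τ ∪ {n}

  element : Fin q → Carrier
  element = Inverse.to enumeration

  index : Carrier → Fin q
  index = Inverse.from enumeration

  outsideVec : ∀ {m} (τ : Subset m) → Fin (q ℕ.^ ∣ ∁ τ ∣) → Vector F m
  outsideVec (inside  ∷ τ) k zero    = 0#
  outsideVec (inside  ∷ τ) k (suc j) = outsideVec τ k j
  outsideVec (outside ∷ τ) k zero    = element (Fin.quotient {q} (q ℕ.^ ∣ ∁ τ ∣) k)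
  outsideVec (outside ∷ τ) k (suc j) = outsideVec τ (Fin.remainder {q} (q ℕ.^ ∣ ∁ τ ∣) k) j

  outsideVec-injective : ∀ {m} (τ : Subset m) k l → (∀ j → j ∉ τ → outsideVec τ k j ≡ outsideVec τ l j) → k ≡ l
  outsideVec-injective []            zero zero _ = refl
  outsideVec-injective (inside  ∷ τ) k    l    k≗l = outsideVec-injective τ k l λ j j∉τ → k≗l (suc j) (j∉τ ∘ drop-there)
  outsideVec-injective (outside ∷ τ) k    l    k≗l = begin
    k                                        ≡⟨ combine-remQuot {q} Q k ⟨
    Fin.combine (Fin.quotient {q} Q k) (Fin.remainder {q} Q k)
      ≡⟨ cong₂ Fin.combine (Injection.injective (↔⇒↣ enumeration) (k≗l zero λ ()))
                           (outsideVec-injective τ _ _ λ j j∉τ → k≗l (suc j) (j∉τ ∘ drop-there)) ⟩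
    Fin.combine (Fin.quotient {q} Q l) (Fin.remainder {q} Q l) ≡⟨ combine-remQuot {q} Q l ⟩
    l                                        ∎
    where
    open ≡-Reasoning
    Q = q ℕ.^ ∣ ∁ τ ∣

  outsideVec-surjective : ∀ {m} (τ : Subset m) v → ∃ λ k → ∀ j → j ∉ τ → outsideVec τ k j ≡ v j
  outsideVec-surjective []            v = zero , λ ()
  outsideVec-surjective (inside  ∷ τ) v with outsideVec-surjective τ (tail v)
  ... | k , k≗v = k , λ { zero 0∉ → contradiction here 0∉ ; (suc j) j∉ → k≗v j (j∉ ∘ there) }
  outsideVec-surjective (outside ∷ τ) v with outsideVec-surjective τ (tail v)
  ... | k , k≗v = Fin.combine (index (v zero)) k , λ
    { zero    _  → trans (cong (element ∘ proj₁) (remQuot-combine (index (v zero)) k)) (Inverse.strictlyInverseˡ enumeration (v zero))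
    ; (suc j) j∉ → trans (cong (λ r → outsideVec τ (proj₂ r) j) (remQuot-combine (index (v zero)) k)) (k≗v j (j∉ ∘ there))
    }

  -- W τ c is the span of E(τ) and the vector (c , 1), cut out by linear equations.
  W : ∀ {m} → Subset m → Vector F m → VSubset F (suc m)
  W τ c y = ∀ j → j ∉ τ → init y j ≡ last y * c j

  W-cong : ∀ {m} (τ : Subset m) {c d} → (∀ j → j ∉ τ → c j ≡ d j) → W τ c ≐ W τ d
  W-cong τ c≗d y = (λ y∈W j j∉τ → trans (y∈W j j∉τ) (cong (last y *_) (c≗d j j∉τ))) ,
                   (λ y∈W j j∉τ → trans (y∈W j j∉τ) (cong (last y *_) (sym (c≗d j j∉τ))))

  W-injective : ∀ {m} (τ : Subset m) {c d} → W τ c ≐ W τ d → ∀ j → j ∉ τ → c j ≡ d j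
  W-injective τ {c} {d} W≐W j j∉τ = begin
    c j                  ≡⟨ init-snoc c 1# j ⟨
    init (snoc c 1#) j   ≡⟨ proj₁ (W≐W (snoc c 1#)) c1∈W j j∉τ ⟩
    last (snoc c 1#) * d j ≡⟨ trans (cong (_* d j) (last-snoc c 1#)) (*-identityˡ (d j)) ⟩
    d j                  ∎
    where
    open ≡-Reasoning
    c1∈W : W τ c (snoc c 1#)
    c1∈W j _ = trans (init-snoc c 1# j) (sym (trans (cong (_* c j) (last-snoc c 1#)) (*-identityˡ (c j))))

  E⊑W : ∀ {m} (τ : Subset m) c → E (τ ∷ʳ outside) ⊑ W τ c
  E⊑W τ c y y∈E j j∉τ = trans (E-init y∈E j j∉τ) (sym (trans (cong (_* c j) (E-last y∈E)) (zeroˡ (c j))))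

  W≐bordered▸E : ∀ {m} (τ : Subset m) c → W τ c ≐ bordered I c ▸ E (τ ∷ʳ inside)
  W≐bordered▸E τ c y = to , from
    where
    to : W τ c y → (bordered I c ▸ E (τ ∷ʳ inside)) y
    to y∈W = snoc v (last y) , E-snoc v∈E (λ ()) , action
      where
      v = λ j → init y j + - (last y * c j)
      v∈E : E τ v
      v∈E j j∉τ = trans (cong (_+ - (last y * c j)) (y∈W j j∉τ)) (-‿inverseʳ (last y * c j))
      action : ∀ i → (bordered I c · snoc v (last y)) i ≡ y i
      action i with view i
      ... | ‵fromℕ     = trans (·-bordered-last I c (snoc v (last y))) (last-snoc v (last y))
      ... | ‵inject₁ j = begin
        (bordered I c · snoc v (last y)) (inject₁ j)                  ≡⟨ ·-bordered-init I c (snoc v (last y)) j ⟩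
        (I · init (snoc v (last y))) j + c j * last (snoc v (last y))
          ≡⟨ cong₂ _+_ (trans (I·x _ j) (init-snoc v _ j)) (cong (c j *_) (last-snoc v _)) ⟩
        init y j + - (last y * c j) + c j * last y ≡⟨ cong (init y j + - (last y * c j) +_) (*-comm (c j) (last y)) ⟩
        init y j + - (last y * c j) + last y * c j ≡⟨ +-assoc (init y j) _ _ ⟩
        init y j + (- (last y * c j) + last y * c j) ≡⟨ cong (init y j +_) (-‿inverseˡ _) ⟩
        init y j + 0#                              ≡⟨ +-identityʳ (init y j) ⟩
        init y j                                   ∎
        where open ≡-Reasoning
    from : (bordered I c ▸ E (τ ∷ʳ inside)) y → W τ c y
    from (x , x∈E , Ax≡y) j j∉τ = begin
      init y j                                  ≡⟨ Ax≡y (inject₁ j) ⟨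
      (bordered I c · x) (inject₁ j)            ≡⟨ ·-bordered-init I c x j ⟩
      (I · init x) j + c j * last x             ≡⟨ cong (_+ c j * last x) (trans (I·x (init x) j) (E-init x∈E j j∉τ)) ⟩
      0# + c j * last x                         ≡⟨ trans (+-identityˡ _) (*-comm (c j) (last x)) ⟩
      last x * c j                              ≡⟨ cong (_* c j) (trans (sym (·-bordered-last I c x)) (Ax≡y _)) ⟩
      last y * c j                              ∎
      where open ≡-Reasoning

  -- A fixes E(τ), so A E(τ ∪ {n}) is spanned by E(τ) and w = A eₙ, whose last entry a is nonzero.
  module _ {m} {τ : Subset m} {A : Matrix F (suc m)} (borel : InBorel F A)
           (E⊑A▸E : E (τ ∷ʳ outside) ⊑ A ▸ E (τ ∷ʳ inside)) where

    private
      a   = last (last A)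
      a⁻¹ = proj₁ (inverse a (diagonal≢0 borel (fromℕ m)))
      aa⁻¹≡1 : a * a⁻¹ ≡ 1#
      aa⁻¹≡1 = proj₂ (inverse a (diagonal≢0 borel (fromℕ m)))
      w = A · eₙ
      last-w : last w ≡ a
      last-w = trans (·-last (proj₁ borel) eₙ) (trans (cong (a *_) (last-snoc {m = m} 0ᵛ 1#)) (*-identityʳ a))

    slope : Vector F m
    slope j = init w j * a⁻¹

    A▸E⊑E : A ▸ E (τ ∷ʳ outside) ⊑ E (τ ∷ʳ outside)
    A▸E⊑E = E⊑▸E⇒▸E⊑E borel λ v v∈E →
      let (x , x∈E , Ax≡v) = E⊑A▸E v v∈E
          x≡0 = last≡0 borel x (trans (Ax≡v _) (E-last v∈E))
      in x , E-resp _ (snoc-init-last x) (E-snoc (E-init x∈E) λ _ → x≡0) , Ax≡v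

    ▸E⊑W : A ▸ E (τ ∷ʳ inside) ⊑ W τ slope
    ▸E⊑W y (x , x∈E , Ax≡y) j j∉τ = begin
      init y j                                  ≡⟨ y≡ (inject₁ j) ⟩
      (A · x′) (inject₁ j) + last x * init w j  ≡⟨ cong (_+ last x * init w j) (Ax′∈E _ (j∉τ ∘ inject₁∈∷ʳ⁻)) ⟩
      0# + last x * init w j                    ≡⟨ +-identityˡ _ ⟩
      last x * init w j                         ≡⟨ *-identityʳ _ ⟨
      last x * init w j * 1#                    ≡⟨ cong (last x * init w j *_) aa⁻¹≡1 ⟨
      last x * init w j * (a * a⁻¹)             ≡⟨ interchange (last x) (init w j) a a⁻¹ ⟩
      last x * a * slope j                      ≡⟨ cong (_* slope j) last-y ⟨
      last y * slope j                          ∎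
      where
      open ≡-Reasoning
      x′ = snoc (init x) 0#
      Ax′∈E : E (τ ∷ʳ outside) (A · x′)
      Ax′∈E = A▸E⊑E _ (x′ , E-snoc (E-init x∈E) (λ _ → refl) , λ _ → refl)
      x≡x′+xₙeₙ : ∀ k → x k ≡ x′ k + last x * eₙ k
      x≡x′+xₙeₙ k = sym (trans (snoc+*eₙ (init x) 0# (last x) k)
                             (trans (cong (λ c → snoc (init x) c k) (+-identityˡ (last x))) (snoc-init-last x k)))
      y≡ : ∀ i → y i ≡ (A · x′) i + last x * w i
      y≡ i = trans (sym (Ax≡y i)) (trans (·-cong A x≡x′+xₙeₙ i) (·-+* A x′ (last x) eₙ i))
      last-y : last y ≡ last x * a
      last-y = trans (y≡ _) (trans (cong₂ _+_ (E-last Ax′∈E) (cong (last x *_) last-w)) (+-identityˡ _))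

    W⊑▸E : W τ slope ⊑ A ▸ E (τ ∷ʳ inside)
    W⊑▸E y y∈W = ▸-resp A _ (λ i → +-*-cancel (y i) s (w i)) (▸E-+* A _ (E⊑A▸E u u∈E) w∈A▸E s)
      where
      s = last y * a⁻¹
      u = λ i → y i + - s * w i
      w∈A▸E : (A ▸ E (τ ∷ʳ inside)) w
      w∈A▸E = eₙ , E-snoc (λ _ _ → refl) (λ ()) , λ _ → refl
      init-u∈E : E τ (init u)
      init-u∈E j j∉τ = trans (cong (_+ - s * init w j) (trans (y∈W j j∉τ) (x∙yz≈xz∙y (last y) (init w j) a⁻¹)))
                             (*-inverseʳ s (init w j))
      s*a≡yₙ : s * a ≡ last y
      s*a≡yₙ = trans (xy∙z≈x∙zy (last y) a⁻¹ a) (trans (cong (last y *_) aa⁻¹≡1) (*-identityʳ (last y)))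
      last-u≡0 : last u ≡ 0#
      last-u≡0 = trans (cong₂ (λ t z → t + - s * z) (sym s*a≡yₙ) last-w) (*-inverseʳ s a)
      u∈E : E (τ ∷ʳ outside) u
      u∈E = E-resp _ (snoc-init-last u) (E-snoc init-u∈E λ _ → last-u≡0)

  incident⇒W : ∀ {m} {τ : Subset m} {T} → Incident (τ ∷ʳ outside) (τ ∷ʳ inside) T → ∃ λ c → T ≐ W τ c
  incident⇒W ((_ , borel , T≐) , E⊑T) =
    slope borel E⊑A▸E , ≐-trans T≐ λ y → ▸E⊑W borel E⊑A▸E y , W⊑▸E borel E⊑A▸E y
    where E⊑A▸E = λ v → proj₁ (T≐ v) ∘ E⊑T v

  IncidenceCount-τ-τ∪n : ∀ {m} (τ : Subset m) → IncidenceCount F (suc m) (τ ∷ʳ outside) (τ ∷ʳ inside) (q ℕ.^ ∣ ∁ τ ∣)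
  IncidenceCount-τ-τ∪n τ =
    W τ ∘ outsideVec τ ,
    (λ k → (bordered I (outsideVec τ k) , InBorel-borderedI _ , W≐bordered▸E τ _) , E⊑W τ _) ,
    (λ k l W≐W → outsideVec-injective τ k l (W-injective τ W≐W)) ,
    λ T T-orbit E⊑T →
      let (c , T≐W) = incident⇒W (T-orbit , E⊑T)
          (k , k≗c) = outsideVec-surjective τ c
      in k , ≐-trans T≐W (W-cong τ (λ j j∉τ → sym (k≗c j j∉τ)))

  -- Finiteness of incidence numbers

  _≟_ : (x y : Carrier) → Dec (x ≡ y)
  x ≟ y = map′ index-injective (cong index) (index x Fin.≟ index y)
    where
    index-injective : index x ≡ index y → x ≡ y
    index-injective ix≡iy = begin
      x                  ≡⟨ Inverse.strictlyInverseˡ enumeration x ⟨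
      element (index x)  ≡⟨ cong element ix≡iy ⟩
      element (index y)  ≡⟨ Inverse.strictlyInverseˡ enumeration y ⟩
      y                  ∎
      where open ≡-Reasoning

  _≗ᵛ_ : ∀ {n} → Vector F n → Vector F n → Set
  x ≗ᵛ y = ∀ i → x i ≡ y i

  _≗ᴹ_ : ∀ {n} → Matrix F n → Matrix F n → Set
  A ≗ᴹ B = ∀ i j → A i j ≡ B i j

  vectors : ∀ n → Enumeration (Vector F n) _≗ᵛ_
  vectors n = enumeration-→ {_≈_ = _≡_} n record
    { size = q ; enum = element ; enum-surjective = λ a → index a , Inverse.strictlyInverseˡ enumeration a }

  matrices : ∀ n → Enumeration (Matrix F n) _≗ᴹ_
  matrices n = enumeration-→ n (vectors n)

  ▸-congˡ : ∀ {n} {A B : Matrix F n} (S : VSubset F n) → A ≗ᴹ B → A ▸ S ≐ B ▸ S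
  ▸-congˡ {A = A} {B} S A≗B v =
    (λ (x , x∈S , Ax≡v) → x , x∈S , λ i → trans (∑-cong λ j → cong (_* x j) (sym (A≗B i j))) (Ax≡v i)) ,
    (λ (x , x∈S , Bx≡v) → x , x∈S , λ i → trans (∑-cong λ j → cong (_* x j) (A≗B i j)) (Bx≡v i))

  InBorel-resp : ∀ {n} {A B : Matrix F n} → A ≗ᴹ B → InBorel F A → InBorel F B
  InBorel-resp {A = A} {B} A≗B (ut , C , AC≡I , CA≡I) =
    (λ i j j<i → trans (sym (A≗B i j)) (ut i j j<i)) , C ,
    (λ i k → trans (∑-cong λ j → cong (_* C j k) (sym (A≗B i j))) (AC≡I i k)) ,
    (λ i k → trans (∑-cong λ j → cong (C i j *_) (sym (A≗B j k))) (CA≡I i k))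

  module _ {n : ℕ} where
    open Enumerated (vectors n) (sym ∘_) using () renaming (all?ᵉ to all-vectors?; any?ᵉ to any-vector?)

    E? : (ρ : Subset n) → ∀ x → Dec (E ρ x)
    E? ρ x = all? λ j → ¬? (j ∈? ρ) →-dec (x j ≟ 0#)

    ▸E? : ∀ A (ρ : Subset n) v → Dec ((A ▸ E ρ) v)
    ▸E? A ρ v = any-vector? (λ x≗y (x∈E , Ax≡v) → E-resp ρ x≗y x∈E , λ i → trans (sym (·-cong A x≗y i)) (Ax≡v i))
                            λ x → E? ρ x ×-dec all? λ i → (A · x) i ≟ v i

    E⊑▸E? : ∀ A (τ π : Subset n) → Dec (E τ ⊑ A ▸ E π)
    E⊑▸E? A τ π = all-vectors? (λ v≗w τ⇒π w∈E → ▸-resp A _ v≗w (τ⇒π (E-resp τ (sym ∘ v≗w) w∈E)))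
                               λ v → E? τ v →-dec ▸E? A π v

    ▸E≐▸E? : ∀ A B (π : Subset n) → Dec (A ▸ E π ≐ B ▸ E π)
    ▸E≐▸E? A B π = all-vectors?
      (λ v≗w (A⇒B , B⇒A) → ▸-resp B _ v≗w ∘ A⇒B ∘ ▸-resp A _ (sym ∘ v≗w) ,
                           ▸-resp A _ v≗w ∘ B⇒A ∘ ▸-resp B _ (sym ∘ v≗w))
      λ v → (▸E? A π v →-dec ▸E? B π v) ×-dec (▸E? B π v →-dec ▸E? A π v)

    InBorel? : ∀ A → Dec (InBorel F A)
    InBorel? A = (all? λ i → all? λ j → toℕ j ℕ.<? toℕ i →-dec A i j ≟ 0#) ×-dec
      Enumerated.any?ᵉ (matrices n) (λ B≗C i j → sym (B≗C i j))
        (λ B≗C (AB≡I , BA≡I) → (λ i k → trans (∑-cong λ j → cong (A i j *_) (sym (B≗C j k))) (AB≡I i k)) ,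
                               (λ i k → trans (∑-cong λ j → cong (_* A j k) (sym (B≗C i j))) (BA≡I i k)))
        λ B → (all? λ i → all? λ k → (A ⊗ B) i k ≟ I i k) ×-dec (all? λ i → all? λ k → (B ⊗ A) i k ≟ I i k)

  incidence-finite : ∀ n (τ π : Subset n) → ∃ (IncidenceCount F n τ π)
  incidence-finite n τ π = size , (λ i → rep i ▸ E π) , (λ i → (rep i , proj₁ (rep-P i) , ≐-refl) , proj₂ (rep-P i)) ,
                         rep-distinct , complete
    where
    open Enumeration (matrices n) using (enum; enum-surjective)
    open Transversal (transversal (λ A → InBorel? A ×-dec E⊑▸E? A τ π) (λ A B → ▸E≐▸E? A B π) ≐-refl ≐-sym enum)
    complete : ∀ T → InOrbitOfE F π T → E τ ⊑ T → ∃ λ i → T ≐ rep i ▸ E π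
    complete T (A , borel , T≐) E⊑T =
      let (k , Aₖ≗A) = enum-surjective A
          (i , Aₖ≐repᵢ) = rep-complete k (InBorel-resp (λ i j → sym (Aₖ≗A i j)) borel ,
                                           λ v → proj₂ (▸-congˡ (E π) Aₖ≗A v) ∘ proj₁ (T≐ v) ∘ E⊑T v)
      in i , ≐-trans T≐ (≐-trans (≐-sym (▸-congˡ (E π) Aₖ≗A)) Aₖ≐repᵢ)

open import Data.Nat using (_+_; _∸_; _^_; _≤_)

lemma5 : ∀ {q : ℕ} (F : FiniteField q) (m t : ℕ) → 1 ≤ t → t + 2 ≤ suc m →
    (∀ (τ σ : Subset m) → ∣ τ ∣ ≡ t → ∣ σ ∣ ≡ t →
    (σ ≡ τ → IncidenceCount F (suc m) (embed τ) (addLast σ) (q ^ (m ∸ t)))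
    × (¬ (σ ≡ τ) → IncidenceCount F (suc m) (embed τ) (addLast σ) 0))
    × (∀ (τ π : Subset m) → ∣ τ ∣ ≡ t → ∣ π ∣ ≡ t + 2 →
    ∃ λ N → IncidenceCount F (suc m) (embed τ) (embed π) N × IncidenceCount F m τ π N)
    × (∀ (τ σ : Subset m) → ∣ τ ∣ ≡ t ∸ 1 → ∣ σ ∣ ≡ t →
    ∃ λ N → IncidenceCount F (suc m) (addLast τ) (addLast σ) N × IncidenceCount F m τ σ N)
    × (∀ (τ π : Subset m) → ∣ τ ∣ ≡ t ∸ 1 → ∣ π ∣ ≡ t + 2 →
    IncidenceCount F (suc m) (addLast τ) (embed π) 0)
lemma5 {q} F m t _ _ = part-i , (λ τ π _ _ → extend outside τ π) , (λ τ σ _ _ → extend inside τ σ) , part-iv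
  where
  part-i : ∀ (τ σ : Subset m) → ∣ τ ∣ ≡ t → ∣ σ ∣ ≡ t →
    (σ ≡ τ → IncidenceCount F (suc m) (embed τ) (addLast σ) (q ^ (m ∸ t)))
    × (¬ (σ ≡ τ) → IncidenceCount F (suc m) (embed τ) (addLast σ) 0)
  part-i τ σ ∣τ∣≡t ∣σ∣≡t =
    (λ { refl → subst (IncidenceCount F (suc m) (embed τ) (addLast τ) ∘ (q ^_))
                      (trans (∣∁p∣≡n∸∣p∣ τ) (cong (m ∸_) ∣τ∣≡t)) (IncidenceCount-τ-τ∪n F τ) }) ,
    λ σ≢τ → IncidenceCount-zero F λ τ⊆σ → σ≢τ (sym (p⊆q∧∣p∣≡∣q∣⇒p≡q (inject₁∈∷ʳ⁻ ∘ τ⊆σ ∘ inject₁∈∷ʳ⁺)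
                                                                 (trans ∣τ∣≡t (sym ∣σ∣≡t))))
  extend : ∀ b (τ π : Subset m) → ∃ λ N → IncidenceCount F (suc m) (τ ∷ʳ b) (π ∷ʳ b) N × IncidenceCount F m τ π N
  extend b τ π = let (N , count) = incidence-finite F m τ π
                 in N , IncidenceCount-transport F (extension F τ π b) count , count
  part-iv : ∀ (τ π : Subset m) → ∣ τ ∣ ≡ t ∸ 1 → ∣ π ∣ ≡ t + 2 → IncidenceCount F (suc m) (addLast τ) (embed π) 0
  part-iv τ π _ _ = IncidenceCount-zero F λ τ∪n⊆π → fromℕ∉∷ʳoutside π (τ∪n⊆π (fromℕ∈∷ʳinside τ))
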